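{- Let $m$ be a positive integer with $m\equiv 5\pmod 8$. If $m=\sum_{i=0}^k4^i$ for some $k\ge1$, then $(m,S(m),S^2(m))=(m,1,1)$. Otherwise, the triple $(m,S(m),S^2(m))$ has permutation pattern $(3,2,1)$ or $(3,1,2)$. Moreover, the set of $m\equiv 5\pmod 8$ whose triple has pattern $(3,2,1)$ has density $1/8$, and the set of $m\equiv5\pmod 8$ whose triple has pattern $(3,1,2)$ has density $1/8$, where the density of a set $A$ of odd positive integers means $\lim_{M\to\infty}\#\{a\in A:a\le M\}/(M/2)$.
   Context: The Syracuse function $S$ on odd positive integers is defined by $S(m)=(3m+1)/2^e$, where $e$ is the largest integer with $2^e\mid 3m+1$. For a triple $(x_1,x_2,x_3)$ of distinct reals with coordinates in increasing order $y_1<y_2<y_3$, its permutation pattern is the permutation $\sigma$ of $\{1,2,3\}$ with $x_i=y_{\sigma(i)}$, written $(\sigma(1),\sigma(2),\sigma(3))$. -}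

module Defs where

open import Data.Nat using (ℕ; zero; suc; _+_; _*_; _^_; _≤_; _<ᵇ_; NonZero)
open import Data.Nat.DivMod using (_/_; _%_)
open import Data.Nat.Properties using (_≟_)
open import Data.Bool using (if_then_else_)
open import Data.Nat.ListAction using (sum)
open import Data.List using (List; map; upTo; filter; length)
open import Data.Product using (_×_; _,_; ∃; Σ)
open import Data.Integer using (+_)
open import Data.Rational using (ℚ; ∣_∣; _-_; Positive)
import Data.Rational as ℚ
open import Relation.Nullary using (¬_; Dec)
open import Relation.Nullary.Decidable using (_×-dec_; ¬?)
open import Relation.Unary using (Pred; Decidable)
open import Relation.Binary.PropositionalEquality using (_≡_; _≢_)
open import Level using (0ℓ)

-- Odd part of n: divide out 2 as long as possible (fuel n suffices for n ≥ 1).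
oddPartAux : ℕ → ℕ → ℕ
oddPartAux zero n = n
oddPartAux (suc f) n with n % 2
... | zero = oddPartAux f (n / 2)
... | suc _ = n

oddPart : ℕ → ℕ
oddPart n = oddPartAux n n

S : ℕ → ℕ
S m = oddPart (3 * m + 1)

Triple : Set
Triple = ℕ × ℕ × ℕ

syrTriple : ℕ → Triple
syrTriple m = m , S m , S (S m)

ind< : ℕ → ℕ → ℕ
ind< x y = if x <ᵇ y then 1 else 0

-- rank of a among {a,b,c} (1 = smallest), for distinct entries
rank : ℕ → ℕ → ℕ → ℕ
rank a b c = 1 + ind< b a + ind< c a

Distinct3 : Triple → Set
Distinct3 (x , y , z) = (x ≢ y) × (x ≢ z) × (y ≢ z)

-- (x1,x2,x3) has permutation pattern (s1,s2,s3): entries distinct and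
-- x_i is the s_i-th smallest entry, i.e. x_i = y_{σ(i)}.
HasPattern : Triple → Triple → Set
HasPattern (x , y , z) (s₁ , s₂ , s₃) =
  Distinct3 (x , y , z) × rank x y z ≡ s₁ × rank y x z ≡ s₂ × rank z x y ≡ s₃

hasPattern? : ∀ t s → Dec (HasPattern t s)
hasPattern? (x , y , z) (s₁ , s₂ , s₃) =
  ((¬? (x ≟ y)) ×-dec ((¬? (x ≟ z)) ×-dec (¬? (y ≟ z))))
  ×-dec ((rank x y z ≟ s₁) ×-dec ((rank y x z ≟ s₂) ×-dec (rank z x y ≟ s₃)))

geom4 : ℕ → ℕ
geom4 k = sum (map (4 ^_) (upTo (suc k)))

IsGeom4 : ℕ → Set
IsGeom4 m = ∃ λ k → 1 ≤ k × m ≡ geom4 k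

countUpTo : (A : Pred ℕ 0ℓ) → Decidable A → ℕ → ℕ
countUpTo A A? M = length (filter A? (upTo (suc M)))

-- density of a set A of odd positive integers:
--   lim_{M→∞} #{a ∈ A : a ≤ M} / (M/2) = d   (M ranging over positive integers)
HasDensity : (A : Pred ℕ 0ℓ) → Decidable A → ℚ → Set
HasDensity A A? d =
  ∀ (ε : ℚ) → Positive ε → ∃ λ N → ∀ M → N ≤ M →
    ∣ ((+ (2 * countUpTo A A? (suc M))) ℚ./ (suc M)) - d ∣ ℚ.< ε

A-pat : Triple → Pred ℕ 0ℓ
A-pat s m = (m % 8 ≡ 5) × HasPattern (syrTriple m) s

A-pat? : ∀ s → Decidable (A-pat s)
A-pat? s m = (m % 8 ≟ 5) ×-dec hasPattern? (syrTriple m) s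

-- For m = 8q + 5 we have 3m + 1 = 8(3q + 2), so s = S m is the odd part of 3q + 2 and s < m.
-- If s = 1, then m = 1 + 4 + ... + 4^k, because S(4x + 1) = S x. If s ≡ 1 (mod 4) and s > 1,
-- then S s < s, because S(4x + 1) = S x ≤ 3x + 1: pattern (3,2,1). If s ≡ 3 (mod 4), then
-- S s = (3s + 1)/2 lies strictly between s and m: pattern (3,1,2).
--
-- For the densities it remains to show that, among q < w, the odd part of 3q + 2 is ≡ 1 and
-- ≡ 3 (mod 4) equally often up to o(w). Splitting q by parity, the odd part of 3q + 2 becomes
-- the odd part of 3p + 1 (q = 2p) or the odd number 6p + 5 (q = 2p + 1); symmetrically the odd
-- part of 3q + 1 becomes 6p + 1 or the odd part of 3p + 2. The residues of 6p + 5 and 6p + 1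
-- mod 4 alternate with p, so unfolding k times bounds the imbalance by 4k + w/2^k.

module Submission where

open import Defs
open import Data.Nat using (ℕ; _<_; _%_)
open import Data.Product using (_×_; _,_)
open import Data.Sum using (_⊎_)
open import Data.Integer using (+_)
open import Data.Rational using (_/_)
open import Relation.Nullary using (¬_)
open import Relation.Binary.PropositionalEquality using (_≡_)

open import Data.Bool using (Bool; true; false; not)
open import Data.List using (upTo; filter; length; [_]; _++_; map; applyUpTo)
open import Data.List.Properties using (upTo-∷ʳ; filter-++; length-++)
open import Data.Nat using (zero; suc; _+_; _*_; _^_; _≤_; _≤′_; ≤′-refl; ≤′-step; ∣_-_∣; _<ᵇ_; _<?_; z≤n; s≤s; nonZero)
open import Data.Nat.Coprimality using (Coprime)
open import Data.Nat.DivMod using (m≡m%n+[m/n]*n; m%n<n; [m+kn]%n≡m%n; m*n%n≡0; m*n/n≡m; m/n≤m; m/n*n≤m)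
  renaming (_/_ to _div_)
open import Data.Nat.Induction using (<-rec)
open import Data.Nat.ListAction using (sum)
open import Data.Nat.Properties
open import Data.Nat.Tactic.RingSolver using (solve-∀)
open import Data.Product using (∃; proj₁; proj₂)
open import Data.Sum using (inj₁; inj₂)
open import Function using (_∘_; _⇔_; mk⇔)
open import Level using (0ℓ)
open import Relation.Binary.PropositionalEquality using (refl; sym; trans; cong; cong₂; subst; subst₂; _≢_; module ≡-Reasoning)
open import Relation.Nullary using (does; contradiction)
open import Relation.Nullary.Decidable using (dec-true; dec-false; does-⇔)
open import Relation.Nullary.Reflects using (ofʸ; ofⁿ)
open import Relation.Unary using (Pred; Decidable)
import Data.Integer as ℤ
import Data.Integer.Properties as ℤ
import Data.Rational as ℚ
import Data.Rational.Properties as ℚ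
import Data.Rational.Unnormalised as ℚᵘ
import Data.Rational.Unnormalised.Properties as ℚᵘ

≤-offset : ∀ {m n} d → m + d ≡ n → m ≤ n
≤-offset {m} d refl = m≤m+n m d

m*2≤1+n⇒m≤n : ∀ m n → m * 2 ≤ suc n → m ≤ n
m*2≤1+n⇒m≤n zero n _ = z≤n
m*2≤1+n⇒m≤n (suc m) n 2m≤1+n = ≤-trans (s≤s (m≤m*n m 2)) (≤-pred 2m≤1+n)

n≤2^n : ∀ n → n ≤ 2 ^ n
n≤2^n zero = z≤n
n≤2^n (suc n) =
  subst (suc n ≤_) (cong (λ x → 2 ^ n + x) (sym (+-identityʳ (2 ^ n)))) (+-mono-≤ (m^n>0 2 n) (n≤2^n n))

m≤n+o⇒n≤m+o⇒∣m-n∣≤o : ∀ {m n o} → m ≤ n + o → n ≤ m + o → ∣ m - n ∣ ≤ o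
m≤n+o⇒n≤m+o⇒∣m-n∣≤o {m} {n} m≤n+o n≤m+o with ≤-total m n
... | inj₁ m≤n = subst (_≤ _) (sym (m≤n⇒∣m-n∣≡n∸m m≤n)) (m≤n+o⇒m∸n≤o n m n≤m+o)
... | inj₂ n≤m = subst (_≤ _) (sym (m≤n⇒∣n-m∣≡n∸m n≤m)) (m≤n+o⇒m∸n≤o m n m≤n+o)

∣1+m-n∣≤1+∣m-n∣ : ∀ m n → ∣ suc m - n ∣ ≤ suc ∣ m - n ∣
∣1+m-n∣≤1+∣m-n∣ zero zero = ≤-refl
∣1+m-n∣≤1+∣m-n∣ zero (suc n) = m≤n⇒m≤1+n (n≤1+n n)
∣1+m-n∣≤1+∣m-n∣ (suc m) zero = ≤-refl
∣1+m-n∣≤1+∣m-n∣ (suc m) (suc n) = ∣1+m-n∣≤1+∣m-n∣ m n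

∣m-1+n∣≤1+∣m-n∣ : ∀ m n → ∣ m - suc n ∣ ≤ suc ∣ m - n ∣
∣m-1+n∣≤1+∣m-n∣ m n = subst₂ (λ x y → x ≤ suc y) (∣-∣-comm (suc n) m) (∣-∣-comm n m) (∣1+m-n∣≤1+∣m-n∣ n m)

∣m+n-o+p∣≤∣m-o∣+∣n-p∣ : ∀ m n o p → ∣ m + n - o + p ∣ ≤ ∣ m - o ∣ + ∣ n - p ∣
∣m+n-o+p∣≤∣m-o∣+∣n-p∣ m n o p = begin
  ∣ m + n - o + p ∣                   ≤⟨ ∣-∣-triangle (m + n) (o + n) (o + p) ⟩
  ∣ m + n - o + n ∣ + ∣ o + n - o + p ∣ ≡⟨ cong₂ _+_ (cong₂ ∣_-_∣ (+-comm m n) (+-comm o n)) (∣m+n-m+o∣≡∣n-o∣ o n p) ⟩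
  ∣ n + m - n + o ∣ + ∣ n - p ∣         ≡⟨ cong (_+ ∣ n - p ∣) (∣m+n-m+o∣≡∣n-o∣ n m o) ⟩
  ∣ m - o ∣ + ∣ n - p ∣                 ∎
  where open ≤-Reasoning

data Parity : ℕ → Set where
  even : ∀ k → Parity (k * 2)
  odd  : ∀ k → Parity (1 + k * 2)

parity : ∀ n → Parity n
parity zero = even 0
parity (suc n) with parity n
... | even k = odd k
... | odd k = even (suc k)

1+[1+i*2]*2≡3+i*4 : ∀ i → 1 + (1 + i * 2) * 2 ≡ 3 + i * 4
1+[1+i*2]*2≡3+i*4 = solve-∀

1+i*2*2≡1+i*4 : ∀ i → 1 + i * 2 * 2 ≡ 1 + i * 4
1+i*2*2≡1+i*4 = solve-∀

⌊_/2^_⌋ : ℕ → ℕ → ℕ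
⌊ n /2^ zero ⌋ = n
⌊ n /2^ suc k ⌋ = ⌊ n div 2 /2^ k ⌋

⌊n/2^k⌋*2^k≤n : ∀ n k → ⌊ n /2^ k ⌋ * 2 ^ k ≤ n
⌊n/2^k⌋*2^k≤n n zero = ≤-reflexive (*-identityʳ n)
⌊n/2^k⌋*2^k≤n n (suc k) = begin
  ⌊ n div 2 /2^ k ⌋ * (2 * 2 ^ k) ≡⟨ reassoc ⌊ n div 2 /2^ k ⌋ (2 ^ k) ⟩
  ⌊ n div 2 /2^ k ⌋ * 2 ^ k * 2   ≤⟨ *-monoˡ-≤ 2 (⌊n/2^k⌋*2^k≤n (n div 2) k) ⟩
  n div 2 * 2                      ≤⟨ m/n*n≤m n 2 ⟩
  n                                ∎
  where
  open ≤-Reasoning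
  reassoc : ∀ a b → a * (2 * b) ≡ a * b * 2
  reassoc = solve-∀

-- Counting and imbalance

bit : Bool → ℕ
bit true = 1
bit false = 0

bit+bit∘not : ∀ b → bit b + bit (not b) ≡ 1
bit+bit∘not true = refl
bit+bit∘not false = refl

count : (ℕ → Bool) → ℕ → ℕ
count g zero = 0
count g (suc n) = count g n + bit (g n)

length-filter-upTo : {A : Pred ℕ 0ℓ} (A? : Decidable A) → ∀ n →
  length (filter A? (upTo n)) ≡ count (does ∘ A?) n
length-filter-upTo A? zero = refl
length-filter-upTo A? (suc n) = begin
  length (filter A? (upTo (suc n)))                      ≡⟨ cong (length ∘ filter A?) (upTo-∷ʳ n) ⟨
  length (filter A? (upTo n ++ [ n ]))                   ≡⟨ cong length (filter-++ A? (upTo n) [ n ]) ⟩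
  length (filter A? (upTo n) ++ filter A? [ n ])         ≡⟨ length-++ (filter A? (upTo n)) ⟩
  length (filter A? (upTo n)) + length (filter A? [ n ]) ≡⟨ cong₂ _+_ (length-filter-upTo A? n) (length-filter-[ n ]) ⟩
  count (does ∘ A?) (suc n)                              ∎
  where
  open ≡-Reasoning
  length-filter-[_] : ∀ x → length (filter A? [ x ]) ≡ bit (does (A? x))
  length-filter-[ x ] with does (A? x)
  ... | true = refl
  ... | false = refl

count-ext : ∀ {g h} → (∀ x → g x ≡ h x) → ∀ n → count g n ≡ count h n
count-ext g≗h zero = refl
count-ext g≗h (suc n) = cong₂ _+_ (count-ext g≗h n) (cong bit (g≗h n))

count-mono : ∀ g {m n} → m ≤ n → count g m ≤ count g n
count-mono g m≤n = mono (≤⇒≤′ m≤n)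
  where
  mono : ∀ {m n} → m ≤′ n → count g m ≤ count g n
  mono ≤′-refl = ≤-refl
  mono (≤′-step m≤′n) = ≤-trans (mono m≤′n) (m≤m+n _ _)

count-suc≤ : ∀ g n → count g (suc n) ≤ suc (count g n)
count-suc≤ g n with g n
... | true = ≤-reflexive (+-comm (count g n) 1)
... | false = ≤-trans (≤-reflexive (+-identityʳ (count g n))) (n≤1+n _)

count-*2 : ∀ g v → count g (v * 2) ≡ count (λ p → g (p * 2)) v + count (λ p → g (1 + p * 2)) v
count-*2 g zero = refl
count-*2 g (suc v) = begin
  count g (v * 2) + bit (g (v * 2)) + bit (g (1 + v * 2))
    ≡⟨ cong (λ c → c + bit (g (v * 2)) + bit (g (1 + v * 2))) (count-*2 g v) ⟩
  evens + odds + bit (g (v * 2)) + bit (g (1 + v * 2))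
    ≡⟨ interchange evens odds _ _ ⟩
  (evens + bit (g (v * 2))) + (odds + bit (g (1 + v * 2))) ∎
  where
  open ≡-Reasoning
  evens = count (λ p → g (p * 2)) v
  odds = count (λ p → g (1 + p * 2)) v
  interchange : ∀ a b c d → a + b + c + d ≡ (a + c) + (b + d)
  interchange = solve-∀

count-*8 : ∀ f g → (∀ m → m % 8 ≢ 5 → f m ≡ false) → (∀ q → f (5 + q * 8) ≡ g q) →
  ∀ w → count f (w * 8) ≡ count g w
count-*8 f g off on zero = refl
count-*8 f g off on (suc w) = trans block (cong₂ _+_ (count-*8 f g off on w) (cong bit (on w)))
  where
  off′ : ∀ r → r % 8 ≢ 5 → f (r + w * 8) ≡ false
  off′ r r≢5 = off (r + w * 8) (r≢5 ∘ trans (sym ([m+kn]%n≡m%n r w 8)))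
  pad : ∀ c b → c + 0 + 0 + 0 + 0 + 0 + b + 0 + 0 ≡ c + b
  pad = solve-∀
  block : count f (suc w * 8) ≡ count f (w * 8) + bit (f (5 + w * 8))
  block rewrite off′ 0 (λ ()) | off′ 1 (λ ()) | off′ 2 (λ ()) | off′ 3 (λ ())
              | off′ 4 (λ ()) | off′ 6 (λ ()) | off′ 7 (λ ())
    = pad (count f (w * 8)) (bit (f (5 + w * 8)))

imbalance : (ℕ → Bool) → ℕ → ℕ
imbalance g n = ∣ 2 * count g n - n ∣

imbalance-suc : ∀ g n → imbalance g (suc n) ≤ suc (imbalance g n)
imbalance-suc g n with g n
... | false = subst (λ x → ∣ 2 * x - suc n ∣ ≤ suc (imbalance g n)) (sym (+-identityʳ (count g n)))
                    (∣m-1+n∣≤1+∣m-n∣ (2 * count g n) n)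
... | true = subst (λ x → ∣ x - suc n ∣ ≤ suc (imbalance g n)) (sym (twice-suc (count g n)))
                   (∣1+m-n∣≤1+∣m-n∣ (2 * count g n) n)
  where
  twice-suc : ∀ c → 2 * (c + 1) ≡ suc (suc (2 * c))
  twice-suc = solve-∀

imbalance-+ˡ : ∀ g r n → imbalance g (r + n) ≤ r + imbalance g n
imbalance-+ˡ g zero n = ≤-refl
imbalance-+ˡ g (suc r) n = ≤-trans (imbalance-suc g (r + n)) (s≤s (imbalance-+ˡ g r n))

imbalance≤ : ∀ g n → imbalance g n ≤ n
imbalance≤ g zero = z≤n
imbalance≤ g (suc n) = ≤-trans (imbalance-suc g n) (s≤s (imbalance≤ g n))

imbalance-split : ∀ g h k v → count g (v * 2) ≡ count h v + count k v →
  imbalance g (v * 2) ≤ imbalance h v + imbalance k v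
imbalance-split g h k v split = begin
  ∣ 2 * count g (v * 2) - v * 2 ∣
    ≡⟨ cong₂ ∣_-_∣ (trans (cong (2 *_) split) (*-distribˡ-+ 2 (count h v) (count k v))) (double v) ⟩
  ∣ 2 * count h v + 2 * count k v - v + v ∣ ≤⟨ ∣m+n-o+p∣≤∣m-o∣+∣n-p∣ (2 * count h v) (2 * count k v) v v ⟩
  imbalance h v + imbalance k v              ∎
  where
  open ≤-Reasoning
  double : ∀ v → v * 2 ≡ v + v
  double = solve-∀

imbalance-alternating : ∀ g → (∀ i → bit (g (2 + i * 2)) + bit (g (3 + i * 2)) ≡ 1) →
  ∀ n → imbalance g n ≤ 3
imbalance-alternating g alt zero = z≤n
imbalance-alternating g alt (suc zero) = ≤-trans (imbalance≤ g 1) (s≤s z≤n)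
imbalance-alternating g alt (suc (suc n)) = bound (parity n)
  where
  count-pairs : ∀ v → count g (2 + v * 2) ≡ count g 2 + v
  count-pairs zero = sym (+-identityʳ _)
  count-pairs (suc v) = begin
    count g (2 + v * 2) + bit (g (2 + v * 2)) + bit (g (3 + v * 2))   ≡⟨ +-assoc (count g (2 + v * 2)) _ _ ⟩
    count g (2 + v * 2) + (bit (g (2 + v * 2)) + bit (g (3 + v * 2))) ≡⟨ cong₂ _+_ (count-pairs v) (alt v) ⟩
    count g 2 + v + 1                                                 ≡⟨ +-assoc (count g 2) v 1 ⟩
    count g 2 + (v + 1)                                               ≡⟨ cong (λ x → count g 2 + x) (+-comm v 1) ⟩
    count g 2 + suc v                                                 ∎
    where open ≡-Reasoning
  imbalance-pairs : ∀ v → imbalance g (2 + v * 2) ≤ 2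
  imbalance-pairs v = begin
    ∣ 2 * count g (2 + v * 2) - 2 + v * 2 ∣ ≡⟨ cong (λ c → ∣ 2 * c - 2 + v * 2 ∣) (count-pairs v) ⟩
    ∣ 2 * (count g 2 + v) - 2 + v * 2 ∣     ≡⟨ cong₂ ∣_-_∣ (shift (count g 2) v) (+-comm 2 (v * 2)) ⟩
    ∣ v * 2 + 2 * count g 2 - v * 2 + 2 ∣   ≡⟨ ∣m+n-m+o∣≡∣n-o∣ (v * 2) _ 2 ⟩
    imbalance g 2                           ≤⟨ imbalance≤ g 2 ⟩
    2                                       ∎
    where
    open ≤-Reasoning
    shift : ∀ c v → 2 * (c + v) ≡ v * 2 + 2 * c
    shift = solve-∀
  bound : ∀ {n} → Parity n → imbalance g (2 + n) ≤ 3
  bound (even v) = ≤-trans (imbalance-pairs v) (n≤1+n 2)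
  bound (odd v) = ≤-trans (imbalance-suc g (2 + v * 2)) (s≤s (imbalance-pairs v))

imbalance-halving : (F E : Bool → ℕ → Bool) →
  (∀ c v → count (F c) (v * 2) ≡ count (F (not c)) v + count (E c) v) →
  (∀ c n → imbalance (E c) n ≤ 3) →
  ∀ k c n → imbalance (F c) n ≤ k * 4 + ⌊ n /2^ k ⌋
imbalance-halving F E split E-bound zero c n = imbalance≤ (F c) n
imbalance-halving F E split E-bound (suc k) c n = begin
  imbalance (F c) n                 ≡⟨ cong (imbalance (F c)) (m≡m%n+[m/n]*n n 2) ⟩
  imbalance (F c) (n % 2 + h * 2)   ≤⟨ imbalance-+ˡ (F c) (n % 2) (h * 2) ⟩
  n % 2 + imbalance (F c) (h * 2)
    ≤⟨ +-mono-≤ (≤-pred (m%n<n n 2)) (imbalance-split (F c) (F (not c)) (E c) h (split c h)) ⟩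
  1 + (imbalance (F (not c)) h + imbalance (E c) h)
    ≤⟨ s≤s (+-mono-≤ (imbalance-halving F E split E-bound k (not c) h) (E-bound c h)) ⟩
  1 + ((k * 4 + ⌊ h /2^ k ⌋) + 3)   ≡⟨ regroup k ⌊ h /2^ k ⌋ ⟩
  suc k * 4 + ⌊ n /2^ suc k ⌋       ∎
  where
  open ≤-Reasoning
  h = n div 2
  regroup : ∀ k x → 1 + ((k * 4 + x) + 3) ≡ suc k * 4 + x
  regroup = solve-∀

oddPartAux-≤ : ∀ f n → oddPartAux f n ≤ n
oddPartAux-≤ zero n = ≤-refl
oddPartAux-≤ (suc f) n with n % 2
... | zero = ≤-trans (oddPartAux-≤ f (n div 2)) (m/n≤m n 2)
... | suc _ = ≤-refl

oddPartAux-odd : ∀ f n → 1 ≤ n → n ≤ f → ∃ λ k → oddPartAux f n ≡ 1 + k * 2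
oddPartAux-odd zero (suc n) _ ()
oddPartAux-odd (suc f) n 1≤n n≤f with parity n
... | odd k rewrite [m+kn]%n≡m%n 1 k 2 ⦃ nonZero ⦄ = k , refl
... | even (suc k) rewrite m*n%n≡0 (suc k) 2 ⦃ nonZero ⦄ | m*n/n≡m (suc k) 2 ⦃ nonZero ⦄ =
  oddPartAux-odd f (suc k) (s≤s z≤n) (m*2≤1+n⇒m≤n (suc k) f n≤f)

oddPartAux-fuel : ∀ f n → n ≤ f → oddPartAux (suc f) n ≡ oddPartAux f n
oddPartAux-fuel zero zero _ = refl
oddPartAux-fuel (suc f) n n≤f with parity n
... | odd k rewrite [m+kn]%n≡m%n 1 k 2 ⦃ nonZero ⦄ = refl
... | even k rewrite m*n%n≡0 k 2 ⦃ nonZero ⦄ | m*n/n≡m k 2 ⦃ nonZero ⦄ =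
  oddPartAux-fuel f k (m*2≤1+n⇒m≤n k f n≤f)

oddPartAux-+ : ∀ d n → oddPartAux (d + n) n ≡ oddPart n
oddPartAux-+ zero n = refl
oddPartAux-+ (suc d) n = trans (oddPartAux-fuel (d + n) n (m≤n+m n d)) (oddPartAux-+ d n)

oddPart≤ : ∀ n → oddPart n ≤ n
oddPart≤ n = oddPartAux-≤ n n

oddPart-isOdd : ∀ n → 1 ≤ n → ∃ λ k → oddPart n ≡ 1 + k * 2
oddPart-isOdd n 1≤n = oddPartAux-odd n n 1≤n ≤-refl

oddPart-odd : ∀ k → oddPart (1 + k * 2) ≡ 1 + k * 2
oddPart-odd k rewrite [m+kn]%n≡m%n 1 k 2 ⦃ nonZero ⦄ = refl

oddPart-*2 : ∀ n → 1 ≤ n → oddPart (n * 2) ≡ oddPart n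
oddPart-*2 (suc k) _ rewrite m*n%n≡0 (suc k) 2 ⦃ nonZero ⦄ | m*n/n≡m (suc k) 2 ⦃ nonZero ⦄ =
  trans (cong (λ f → oddPartAux f (suc k)) (fuel k)) (oddPartAux-+ k (suc k))
  where
  fuel : ∀ k → suc (k * 2) ≡ k + suc k
  fuel = solve-∀

oddPart-*4 : ∀ n → 1 ≤ n → oddPart (n * 2 * 2) ≡ oddPart n
oddPart-*4 n 1≤n = trans (oddPart-*2 (n * 2) (≤-trans 1≤n (m≤m*n n 2))) (oddPart-*2 n 1≤n)

S[5+q*8] : ∀ q → S (5 + q * 8) ≡ oddPart (2 + q * 3)
S[5+q*8] q = begin
  oddPart (3 * (5 + q * 8) + 1)     ≡⟨ cong oddPart (split q) ⟩
  oddPart ((2 + q * 3) * 2 * 2 * 2) ≡⟨ oddPart-*2 ((2 + q * 3) * 2 * 2) (s≤s z≤n) ⟩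
  oddPart ((2 + q * 3) * 2 * 2)     ≡⟨ oddPart-*4 (2 + q * 3) (s≤s z≤n) ⟩
  oddPart (2 + q * 3)               ∎
  where
  open ≡-Reasoning
  split : ∀ q → 3 * (5 + q * 8) + 1 ≡ (2 + q * 3) * 2 * 2 * 2
  split = solve-∀

S[3+x*4] : ∀ x → S (3 + x * 4) ≡ 5 + x * 6
S[3+x*4] x = begin
  oddPart (3 * (3 + x * 4) + 1)       ≡⟨ cong oddPart (split x) ⟩
  oddPart ((1 + (2 + x * 3) * 2) * 2) ≡⟨ oddPart-*2 (1 + (2 + x * 3) * 2) (s≤s z≤n) ⟩
  oddPart (1 + (2 + x * 3) * 2)       ≡⟨ oddPart-odd (2 + x * 3) ⟩
  1 + (2 + x * 3) * 2                 ≡⟨ tidy x ⟩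
  5 + x * 6                           ∎
  where
  open ≡-Reasoning
  split : ∀ x → 3 * (3 + x * 4) + 1 ≡ (1 + (2 + x * 3) * 2) * 2
  split = solve-∀
  tidy : ∀ x → 1 + (2 + x * 3) * 2 ≡ 5 + x * 6
  tidy = solve-∀

S[1+x*4] : ∀ x → S (1 + x * 4) ≡ S x
S[1+x*4] x = trans (cong oddPart (split x)) (oddPart-*4 (3 * x + 1) (m≤n+m 1 (3 * x)))
  where
  split : ∀ x → 3 * (1 + x * 4) + 1 ≡ (3 * x + 1) * 2 * 2
  split = solve-∀

S[x*2] : ∀ k → S (k * 2) ≡ 1 + k * 6
S[x*2] k = trans (cong oddPart (split k)) (trans (oddPart-odd (k * 3)) (tidy k))
  where
  split : ∀ k → 3 * (k * 2) + 1 ≡ 1 + k * 3 * 2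
  split = solve-∀
  tidy : ∀ k → 1 + k * 3 * 2 ≡ 1 + k * 6
  tidy = solve-∀

<S[3+x*4] : ∀ x → 3 + x * 4 < S (3 + x * 4)
<S[3+x*4] x = subst (3 + x * 4 <_) (sym (S[3+x*4] x)) (+-mono-≤ (n≤1+n 4) (*-monoʳ-≤ x (m≤m+n 4 2)))

S[5+x*4]< : ∀ x → S (1 + suc x * 4) < 1 + suc x * 4
S[5+x*4]< x = begin-strict
  S (1 + suc x * 4)       ≡⟨ S[1+x*4] (suc x) ⟩
  oddPart (3 * suc x + 1) ≤⟨ oddPart≤ (3 * suc x + 1) ⟩
  3 * suc x + 1           <⟨ ≤-offset x (gap x) ⟩
  1 + suc x * 4           ∎
  where
  open ≤-Reasoning
  gap : ∀ x → suc (3 * suc x + 1) + x ≡ 1 + suc x * 4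
  gap = solve-∀

S[5+q*8]<5+q*8 : ∀ q → S (5 + q * 8) < 5 + q * 8
S[5+q*8]<5+q*8 q = begin-strict
  S (5 + q * 8)       ≡⟨ S[5+q*8] q ⟩
  oddPart (2 + q * 3) ≤⟨ oddPart≤ (2 + q * 3) ⟩
  2 + q * 3           <⟨ ≤-offset (2 + q * 5) (gap q) ⟩
  5 + q * 8           ∎
  where
  open ≤-Reasoning
  gap : ∀ q → suc (2 + q * 3) + (2 + q * 5) ≡ 5 + q * 8
  gap = solve-∀

-- Preimages of 1

sum-map-^-suc : ∀ b (f : ℕ → ℕ) n →
  sum (map (b ^_) (applyUpTo (suc ∘ f) n)) ≡ sum (map (b ^_) (applyUpTo f n)) * b
sum-map-^-suc b f zero = refl
sum-map-^-suc b f (suc n) = begin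
  b * b ^ f 0 + sum (map (b ^_) (applyUpTo (suc ∘ f ∘ suc) n))
    ≡⟨ cong (λ s → b * b ^ f 0 + s) (sum-map-^-suc b (f ∘ suc) n) ⟩
  b * b ^ f 0 + sum (map (b ^_) (applyUpTo (f ∘ suc) n)) * b
    ≡⟨ distrib (b ^ f 0) _ b ⟩
  (b ^ f 0 + sum (map (b ^_) (applyUpTo (f ∘ suc) n))) * b ∎
  where
  open ≡-Reasoning
  distrib : ∀ x y b → b * x + y * b ≡ (x + y) * b
  distrib = solve-∀

geom4-suc : ∀ k → geom4 (suc k) ≡ 1 + geom4 k * 4
geom4-suc k = cong suc (sum-map-^-suc 4 (λ i → i) (suc k))

S[geom4] : ∀ k → S (geom4 k) ≡ 1
S[geom4] zero = refl
S[geom4] (suc k) = trans (cong S (geom4-suc k)) (trans (S[1+x*4] (geom4 k)) (S[geom4] k))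

S≡1⇒geom4 : ∀ x → S x ≡ 1 → x ≡ 0 ⊎ ∃ λ k → x ≡ geom4 k
S≡1⇒geom4 = <-rec _ step
  where
  extend : ∀ {i} → i ≡ 0 ⊎ (∃ λ k → i ≡ geom4 k) → ∃ λ k → 1 + i * 4 ≡ geom4 k
  extend (inj₁ refl) = 0 , refl
  extend (inj₂ (k , refl)) = suc k , sym (geom4-suc k)
  step : ∀ x → (∀ {y} → y < x → S y ≡ 1 → y ≡ 0 ⊎ ∃ λ k → y ≡ geom4 k) →
         S x ≡ 1 → x ≡ 0 ⊎ ∃ λ k → x ≡ geom4 k
  step x rec S≡1 with parity x
  ... | even zero = inj₁ refl
  ... | even (suc k) = contradiction (trans (sym (S[x*2] (suc k))) S≡1) λ ()
  ... | odd j with parity j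
  ...   | odd i = contradiction (trans (sym (trans (cong S (1+[1+i*2]*2≡3+i*4 i)) (S[3+x*4] i))) S≡1) λ ()
  ...   | even i = inj₂ (subst (λ y → ∃ λ k → y ≡ geom4 k) (sym (1+i*2*2≡1+i*4 i)) (extend (rec i<x S[i]≡1)))
    where
    i<x : i < 1 + i * 2 * 2
    i<x = s≤s (≤-trans (m≤m*n i 2) (m≤m*n (i * 2) 2))
    S[i]≡1 : S i ≡ 1
    S[i]≡1 = trans (sym (trans (cong S (1+i*2*2≡1+i*4 i)) (S[1+x*4] i))) S≡1

S≡1⇒IsGeom4 : ∀ m → 1 < m → S m ≡ 1 → IsGeom4 m
S≡1⇒IsGeom4 m 1<m S≡1 with S≡1⇒geom4 m S≡1
... | inj₂ (suc k , m≡) = suc k , s≤s z≤n , m≡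
... | inj₁ refl = contradiction 1<m λ ()
... | inj₂ (zero , refl) = contradiction 1<m (<-irrefl refl)

syrTriple-geom4 : ∀ m → IsGeom4 m → syrTriple m ≡ (m , 1 , 1)
syrTriple-geom4 m (k , _ , refl) = cong (λ s → (geom4 k , s , S s)) (S[geom4] k)

-- The second step of the trajectory of 8q + 5

data Trajectory (m s : ℕ) : Set where
  hits-1   : s ≡ 1 → Trajectory m s
  descends : S s < s → Trajectory m s
  ascends  : s < S s → S s < m → Trajectory m s

trajectory-odd : ∀ q j → 1 + j * 2 ≤ 2 + q * 3 → Trajectory (5 + q * 8) (1 + j * 2)
trajectory-odd q j s≤ with parity j
... | even zero = hits-1 refl
... | even (suc i) = descends (subst (λ s → S s < s) (sym (1+i*2*2≡1+i*4 (suc i))) (S[5+x*4]< i))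
... | odd i rewrite 1+[1+i*2]*2≡3+i*4 i =
  ascends (<S[3+x*4] i) (subst (_< 5 + q * 8) (sym (S[3+x*4] i)) (begin-strict
    5 + i * 6       <⟨ ≤-offset (i * 2) (gap₁ i) ⟩
    2 * (3 + i * 4) ≤⟨ *-monoʳ-≤ 2 s≤ ⟩
    2 * (2 + q * 3) ≤⟨ ≤-offset (1 + q * 2) (gap₂ q) ⟩
    5 + q * 8       ∎))
  where
  open ≤-Reasoning
  gap₁ : ∀ i → suc (5 + i * 6) + i * 2 ≡ 2 * (3 + i * 4)
  gap₁ = solve-∀
  gap₂ : ∀ q → 2 * (2 + q * 3) + (1 + q * 2) ≡ 5 + q * 8
  gap₂ = solve-∀

trajectory : ∀ q → Trajectory (5 + q * 8) (S (5 + q * 8))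
trajectory q with oddPart-isOdd (2 + q * 3) (s≤s z≤n)
... | j , eq = subst (Trajectory (5 + q * 8)) (sym (trans (S[5+q*8] q) eq))
  (trajectory-odd q j (subst (_≤ 2 + q * 3) eq (oddPart≤ (2 + q * 3))))

ind<-spec : ∀ x y → (x < y × ind< x y ≡ 1) ⊎ (y ≤ x × ind< x y ≡ 0)
ind<-spec x y with x <ᵇ y | <ᵇ-reflects-< x y
... | true | ofʸ x<y = inj₁ (x<y , refl)
... | false | ofⁿ x≮y = inj₂ (≮⇒≥ x≮y , refl)

ind<-< : ∀ {x y} → x < y → ind< x y ≡ 1
ind<-< {x} {y} x<y with ind<-spec x y
... | inj₁ (_ , eq) = eq
... | inj₂ (y≤x , _) = contradiction x<y (≤⇒≯ y≤x)

ind<-≥ : ∀ {x y} → y ≤ x → ind< x y ≡ 0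
ind<-≥ {x} {y} y≤x with ind<-spec x y
... | inj₁ (x<y , _) = contradiction x<y (≤⇒≯ y≤x)
... | inj₂ (_ , eq) = eq

pattern312 : ∀ {x y z} → y < z → z < x → HasPattern (x , y , z) (3 , 1 , 2)
pattern312 y<z z<x
  rewrite ind<-< (<-trans y<z z<x) | ind<-< z<x | ind<-< y<z
        | ind<-≥ (<⇒≤ (<-trans y<z z<x)) | ind<-≥ (<⇒≤ y<z) | ind<-≥ (<⇒≤ z<x)
  = (>⇒≢ (<-trans y<z z<x) , >⇒≢ z<x , <⇒≢ y<z) , refl , refl , refl

pattern321 : ∀ {x y z} → z < y → y < x → HasPattern (x , y , z) (3 , 2 , 1)
pattern321 z<y y<x
  rewrite ind<-< y<x | ind<-< (<-trans z<y y<x) | ind<-< z<y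
        | ind<-≥ (<⇒≤ y<x) | ind<-≥ (<⇒≤ (<-trans z<y y<x)) | ind<-≥ (<⇒≤ z<y)
  = (>⇒≢ y<x , >⇒≢ (<-trans z<y y<x) , >⇒≢ z<y) , refl , refl , refl

-- When y < x, the rank of y is 1 + ind< z y, which pins down the order of y and z.
pattern312⇒< : ∀ {x y z} → y < x → HasPattern (x , y , z) (3 , 1 , 2) → y < z
pattern312⇒< {x} {y} {z} y<x ((_ , _ , y≢z) , _ , rank-y , _) with ind<-spec z y
... | inj₂ (y≤z , _) = ≤∧≢⇒< y≤z y≢z
... | inj₁ (_ , eq) =
  contradiction (trans (cong₂ (λ a b → 1 + a + b) (sym (ind<-≥ (<⇒≤ y<x))) (sym eq)) rank-y) λ ()

pattern321⇒< : ∀ {x y z} → y < x → HasPattern (x , y , z) (3 , 2 , 1) → z < y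
pattern321⇒< {x} {y} {z} y<x (_ , _ , rank-y , _) with ind<-spec z y
... | inj₁ (z<y , _) = z<y
... | inj₂ (_ , eq) =
  contradiction (trans (cong₂ (λ a b → 1 + a + b) (sym (ind<-≥ (<⇒≤ y<x))) (sym eq)) rank-y) λ ()

patterns-5+q*8 : ∀ q → ¬ IsGeom4 (5 + q * 8) →
  HasPattern (syrTriple (5 + q * 8)) (3 , 2 , 1) ⊎ HasPattern (syrTriple (5 + q * 8)) (3 , 1 , 2)
patterns-5+q*8 q ¬geom with trajectory q
... | hits-1 S≡1 = contradiction (S≡1⇒IsGeom4 (5 + q * 8) (s≤s (s≤s z≤n)) S≡1) ¬geom
... | descends t<s = inj₁ (pattern321 t<s (S[5+q*8]<5+q*8 q))
... | ascends s<t t<m = inj₂ (pattern312 s<t t<m)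

A-pat312⇔ascends : ∀ q → A-pat (3 , 1 , 2) (5 + q * 8) ⇔ S (5 + q * 8) < S (S (5 + q * 8))
A-pat312⇔ascends q = mk⇔ (pattern312⇒< (S[5+q*8]<5+q*8 q) ∘ proj₂) λ s<t → [m+kn]%n≡m%n 5 q 8 , ascending s<t
  where
  ascending : S (5 + q * 8) < S (S (5 + q * 8)) → HasPattern (syrTriple (5 + q * 8)) (3 , 1 , 2)
  ascending s<t with trajectory q
  ... | hits-1 s≡1 = contradiction (subst (λ s → s < S s) s≡1 s<t) (<-irrefl refl)
  ... | descends t<s = contradiction s<t (<-asym t<s)
  ... | ascends _ t<m = pattern312 s<t t<m

A-pat321⇔descends : ∀ q → A-pat (3 , 2 , 1) (5 + q * 8) ⇔ S (S (5 + q * 8)) < S (5 + q * 8)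
A-pat321⇔descends q = mk⇔ (pattern321⇒< (S[5+q*8]<5+q*8 q) ∘ proj₂)
  λ t<s → [m+kn]%n≡m%n 5 q 8 , pattern321 t<s (S[5+q*8]<5+q*8 q)

ascent descent : ℕ → Bool
ascent s = does (s <? S s)
descent s = does (S s <? s)

ascent-1mod4 : ∀ k → ascent (1 + suc k * 4) ≡ false
ascent-1mod4 k = dec-false (_ <? _) (<-asym (S[5+x*4]< k))

ascent-3mod4 : ∀ k → ascent (3 + k * 4) ≡ true
ascent-3mod4 k = dec-true (_ <? _) (<S[3+x*4] k)

descent-1mod4 : ∀ k → descent (1 + suc k * 4) ≡ true
descent-1mod4 k = dec-true (_ <? _) (S[5+x*4]< k)

descent-3mod4 : ∀ k → descent (3 + k * 4) ≡ false
descent-3mod4 k = dec-false (_ <? _) (<-asym (<S[3+x*4] k))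

does-A-pat312 : ∀ q → does (A-pat? (3 , 1 , 2) (5 + q * 8)) ≡ ascent (oddPart (2 + q * 3))
does-A-pat312 q = trans (does-⇔ (A-pat312⇔ascends q) (A-pat? _ _) (_ <? _)) (cong ascent (S[5+q*8] q))

does-A-pat321 : ∀ q → does (A-pat? (3 , 2 , 1) (5 + q * 8)) ≡ descent (oddPart (2 + q * 3))
does-A-pat321 q = trans (does-⇔ (A-pat321⇔descends q) (A-pat? _ _) (_ <? _)) (cong descent (S[5+q*8] q))

oddPart3q+ : Bool → ℕ → ℕ
oddPart3q+ true q = oddPart (2 + q * 3)
oddPart3q+ false q = oddPart (1 + q * 3)

6p+ : Bool → ℕ → ℕ
6p+ true p = 5 + p * 6
6p+ false p = 1 + p * 6

count-oddPart3q+ : ∀ (P : ℕ → Bool) c v →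
  count (P ∘ oddPart3q+ c) (v * 2) ≡ count (P ∘ oddPart3q+ (not c)) v + count (P ∘ 6p+ c) v
count-oddPart3q+ P true v =
  trans (count-*2 (P ∘ oddPart3q+ true) v) (cong₂ _+_ (count-ext (cong P ∘ at-even) v) (count-ext (cong P ∘ at-odd) v))
  where
  at-even : ∀ p → oddPart (2 + p * 2 * 3) ≡ oddPart (1 + p * 3)
  at-even p = trans (cong oddPart (halve p)) (oddPart-*2 (1 + p * 3) (s≤s z≤n))
    where halve : ∀ p → 2 + p * 2 * 3 ≡ (1 + p * 3) * 2
          halve = solve-∀
  at-odd : ∀ p → oddPart (2 + (1 + p * 2) * 3) ≡ 5 + p * 6
  at-odd p = trans (cong oddPart (shape p)) (trans (oddPart-odd (2 + p * 3)) (tidy p))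
    where shape : ∀ p → 2 + (1 + p * 2) * 3 ≡ 1 + (2 + p * 3) * 2
          shape = solve-∀
          tidy : ∀ p → 1 + (2 + p * 3) * 2 ≡ 5 + p * 6
          tidy = solve-∀
count-oddPart3q+ P false v =
  trans (count-*2 (P ∘ oddPart3q+ false) v)
        (trans (cong₂ _+_ (count-ext (cong P ∘ at-even) v) (count-ext (cong P ∘ at-odd) v))
               (+-comm (count (P ∘ 6p+ false) v) _))
  where
  at-even : ∀ p → oddPart (1 + p * 2 * 3) ≡ 1 + p * 6
  at-even p = trans (cong oddPart (shape p)) (trans (oddPart-odd (p * 3)) (tidy p))
    where shape : ∀ p → 1 + p * 2 * 3 ≡ 1 + p * 3 * 2
          shape = solve-∀
          tidy : ∀ p → 1 + p * 3 * 2 ≡ 1 + p * 6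
          tidy = solve-∀
  at-odd : ∀ p → oddPart (1 + (1 + p * 2) * 3) ≡ oddPart (2 + p * 3)
  at-odd p = trans (cong oddPart (halve p)) (oddPart-*2 (2 + p * 3) (s≤s z≤n))
    where halve : ∀ p → 1 + (1 + p * 2) * 3 ≡ (2 + p * 3) * 2
          halve = solve-∀

imbalance-oddPart3q+ : ∀ (P : ℕ → Bool) b → (∀ k → P (1 + suc k * 4) ≡ b) → (∀ k → P (3 + k * 4) ≡ not b) →
  ∀ k c n → imbalance (P ∘ oddPart3q+ c) n ≤ k * 4 + ⌊ n /2^ k ⌋
imbalance-oddPart3q+ P b P₁ P₃ =
  imbalance-halving (λ c → P ∘ oddPart3q+ c) (λ c → P ∘ 6p+ c) (count-oddPart3q+ P)
    (λ c → imbalance-alternating (P ∘ 6p+ c) (alternates c))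
  where
  opposite : ∀ {x y} → P x ≡ b → P y ≡ not b → bit (P x) + bit (P y) ≡ 1
  opposite Px Py = trans (cong₂ (λ u v → bit u + bit v) Px Py) (bit+bit∘not b)
  alternates : ∀ c i → bit (P (6p+ c (2 + i * 2))) + bit (P (6p+ c (3 + i * 2))) ≡ 1
  alternates true i = opposite (trans (cong P (r₁ i)) (P₁ (3 + i * 3))) (trans (cong P (r₃ i)) (P₃ (5 + i * 3)))
    where r₁ : ∀ i → 5 + (2 + i * 2) * 6 ≡ 1 + suc (3 + i * 3) * 4
          r₁ = solve-∀
          r₃ : ∀ i → 5 + (3 + i * 2) * 6 ≡ 3 + (5 + i * 3) * 4
          r₃ = solve-∀
  alternates false i = opposite (trans (cong P (r₁ i)) (P₁ (2 + i * 3))) (trans (cong P (r₃ i)) (P₃ (4 + i * 3)))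
    where r₁ : ∀ i → 1 + (2 + i * 2) * 6 ≡ 1 + suc (2 + i * 3) * 4
          r₁ = solve-∀
          r₃ : ∀ i → 1 + (3 + i * 2) * 6 ≡ 3 + (4 + i * 3) * 4
          r₃ = solve-∀

-- Densities

count-5mod8 : ∀ f g → (∀ m → m % 8 ≢ 5 → f m ≡ false) → (∀ q → f (5 + q * 8) ≡ g q) →
  ∀ n → ∣ 2 * count f (suc n) * 8 - n ∣ ≤ imbalance g (suc n div 8) * 8 + 23
count-5mod8 f g off on n = begin
  ∣ 2 * c * 8 - n ∣                             ≤⟨ ∣-∣-triangle (2 * c * 8) (2 * A * 8) n ⟩
  ∣ 2 * c * 8 - 2 * A * 8 ∣ + ∣ 2 * A * 8 - n ∣
    ≤⟨ +-monoʳ-≤ ∣ 2 * c * 8 - 2 * A * 8 ∣ (∣-∣-triangle (2 * A * 8) (w * 8) n) ⟩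
  ∣ 2 * c * 8 - 2 * A * 8 ∣ + (∣ 2 * A * 8 - w * 8 ∣ + ∣ w * 8 - n ∣)
    ≡⟨ cong₂ (λ x y → x + (y + ∣ w * 8 - n ∣)) (sym (*-distribʳ-∣-∣ 8 (2 * c) (2 * A))) (sym (*-distribʳ-∣-∣ 8 (2 * A) w)) ⟩
  ∣ 2 * c - 2 * A ∣ * 8 + (imbalance g w * 8 + ∣ w * 8 - n ∣)
    ≤⟨ +-mono-≤ (*-monoˡ-≤ 8 c≈A) (+-monoʳ-≤ (imbalance g w * 8) w*8≈n) ⟩
  2 * 8 + (imbalance g w * 8 + 7)                ≡⟨ regroup (imbalance g w * 8) ⟩
  imbalance g w * 8 + 23                         ∎
  where
  open ≤-Reasoning
  w = suc n div 8
  c = count f (suc n)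
  A = count g w
  1+n≡ : suc n ≡ suc n % 8 + w * 8
  1+n≡ = m≡m%n+[m/n]*n (suc n) 8
  w*8≤1+n : w * 8 ≤ suc n
  w*8≤1+n = subst (w * 8 ≤_) (sym 1+n≡) (m≤n+m (w * 8) _)
  1+n≤7+w*8 : suc n ≤ 7 + w * 8
  1+n≤7+w*8 = subst (_≤ 7 + w * 8) (sym 1+n≡) (+-monoˡ-≤ (w * 8) (≤-pred (m%n<n (suc n) 8)))
  A≤c : A ≤ c
  A≤c = subst (_≤ c) (count-*8 f g off on w) (count-mono f w*8≤1+n)
  c≤A+1 : c ≤ A + 1
  c≤A+1 = begin
    c                   ≤⟨ count-mono f (≤-trans 1+n≤7+w*8 (n≤1+n _)) ⟩
    count f (suc w * 8) ≡⟨ count-*8 f g off on (suc w) ⟩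
    count g (suc w)     ≤⟨ count-suc≤ g w ⟩
    suc A               ≡⟨ +-comm 1 A ⟩
    A + 1               ∎
  c≈A : ∣ 2 * c - 2 * A ∣ ≤ 2
  c≈A = subst (_≤ 2) (*-distribˡ-∣-∣ 2 c A) (*-monoʳ-≤ 2 (m≤n+o⇒n≤m+o⇒∣m-n∣≤o c≤A+1 (≤-trans A≤c (m≤m+n c 1))))
  w*8≈n : ∣ w * 8 - n ∣ ≤ 7
  w*8≈n = m≤n+o⇒n≤m+o⇒∣m-n∣≤o (≤-trans w*8≤1+n (subst (suc n ≤_) (+-comm 7 n) (m≤n+m (suc n) 6)))
                               (≤-trans (n≤1+n n) (subst (suc n ≤_) (+-comm 7 (w * 8)) 1+n≤7+w*8))
  regroup : ∀ x → 2 * 8 + (x + 7) ≡ x + 23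
  regroup = solve-∀

∣m⊖n∣≡∣m-n∣ : ∀ m n → ℤ.∣ m ℤ.⊖ n ∣ ≡ ∣ m - n ∣
∣m⊖n∣≡∣m-n∣ m n with ≤-total m n
... | inj₁ m≤n = trans (ℤ.∣⊖∣-≤ m≤n) (sym (m≤n⇒∣m-n∣≡n∸m m≤n))
... | inj₂ n≤m = trans (ℤ.∣m⊖n∣≡∣n⊖m∣ m n) (trans (ℤ.∣⊖∣-≤ n≤m) (sym (m≤n⇒∣n-m∣≡n∸m n≤m)))

∣a/n-1/8∣< : ∀ a M p q .(coprime : Coprime (suc p) (suc q)) →
  ∣ a * 8 - suc M ∣ * suc q < suc p * (suc M * 8) →
  ℚ.∣ (+ a) / suc M ℚ.- (+ 1) / 8 ∣ ℚ.< ℚ.mkℚ ℤ.+[1+ p ] q coprime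
∣a/n-1/8∣< a M p q coprime bound = ℚ.toℚᵘ-cancel-< (ℚᵘ.<-respˡ-≃ (ℚᵘ.≃-sym unnormalise) cross)
  where
  numerator : ℤ.ℤ
  numerator = (+ a) ℤ.* (+ 8) ℤ.+ ℤ.-[1+ 0 ] ℤ.* (+ suc M)
  ∣numerator∣ : ℤ.∣ numerator ∣ ≡ ∣ a * 8 - suc M ∣
  ∣numerator∣ = trans (cong ℤ.∣_∣ (trans (cong₂ ℤ._+_ (sym (ℤ.pos-* a 8)) (ℤ.-1*i≡-i (+ suc M))) (ℤ.m-n≡m⊖n (a * 8) (suc M))))
                      (∣m⊖n∣≡∣m-n∣ (a * 8) (suc M))
  unnormalise : ℚ.toℚᵘ (ℚ.∣ (+ a) / suc M ℚ.- (+ 1) / 8 ∣) ℚᵘ.≃ ℚᵘ.∣ ℚᵘ.mkℚᵘ (+ a) M ℚᵘ.- ℚᵘ.mkℚᵘ (+ 1) 7 ∣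
  unnormalise =
    ℚᵘ.≃-trans (ℚ.toℚᵘ-homo-∣-∣ ((+ a) / suc M ℚ.- (+ 1) / 8))
      (ℚᵘ.∣-∣-cong (ℚᵘ.≃-trans (ℚ.toℚᵘ-homo-+ ((+ a) / suc M) (ℚ.- ((+ 1) / 8)))
        (ℚᵘ.+-cong (ℚ.toℚᵘ-fromℚᵘ (ℚᵘ.mkℚᵘ (+ a) M))
          (ℚᵘ.≃-trans (ℚ.toℚᵘ-homo‿- ((+ 1) / 8)) (ℚᵘ.-‿cong (ℚ.toℚᵘ-fromℚᵘ (ℚᵘ.mkℚᵘ (+ 1) 7)))))))
  cross : ℚᵘ.∣ ℚᵘ.mkℚᵘ (+ a) M ℚᵘ.- ℚᵘ.mkℚᵘ (+ 1) 7 ∣ ℚᵘ.< ℚᵘ.mkℚᵘ ℤ.+[1+ p ] q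
  cross = ℚᵘ.*<* (subst₂ ℤ._<_ (ℤ.pos-* ℤ.∣ numerator ∣ (suc q)) (ℤ.pos-* (suc p) (suc M * 8))
            (ℤ.+<+ (subst (λ e → e * suc q < suc p * (suc M * 8)) (sym ∣numerator∣) bound)))

-- The depth of unfolding is the denominator d of ε, so that ⌊w/2^d⌋ · d ≤ w.
hasDensity-1/8 : (A : Pred ℕ 0ℓ) (A? : Decidable A) (g : ℕ → Bool) (a : ℕ) →
  (∀ m → m % 8 ≢ 5 → ¬ A m) → (∀ q → does (A? (5 + q * 8)) ≡ g q) →
  (∀ k w → imbalance g w ≤ k * a + ⌊ w /2^ k ⌋) →
  HasDensity A A? ((+ 1) / 8)
hasDensity-1/8 A A? g a off on bound (ℚ.mkℚ ℤ.+[1+ p ] q coprime) _ = N , close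
  where
  d = suc q
  N = (d * a * 8 + 23) * d
  f = does ∘ A?
  close : ∀ M → N ≤ M → ℚ.∣ (+ (2 * countUpTo A A? (suc M))) / suc M ℚ.- (+ 1) / 8 ∣ ℚ.< ℚ.mkℚ ℤ.+[1+ p ] q coprime
  close M N≤M rewrite length-filter-upTo A? (suc (suc M)) = ∣a/n-1/8∣< (2 * c) M p q coprime (begin-strict
    ∣ 2 * c * 8 - suc M ∣ * d
      ≤⟨ *-monoˡ-≤ d (count-5mod8 f g (λ m → dec-false (A? m) ∘ off m) on (suc M)) ⟩
    (imbalance g w * 8 + 23) * d             ≤⟨ *-monoˡ-≤ d (+-monoˡ-≤ 23 (*-monoˡ-≤ 8 (bound d w))) ⟩
    ((d * a + ⌊ w /2^ d ⌋) * 8 + 23) * d     ≡⟨ expand (d * a) ⌊ w /2^ d ⌋ d ⟩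
    N + ⌊ w /2^ d ⌋ * d * 8                  ≤⟨ +-monoʳ-≤ N (*-monoˡ-≤ 8 (*-monoʳ-≤ ⌊ w /2^ d ⌋ (n≤2^n d))) ⟩
    N + ⌊ w /2^ d ⌋ * 2 ^ d * 8              ≤⟨ +-monoʳ-≤ N (*-monoˡ-≤ 8 (⌊n/2^k⌋*2^k≤n w d)) ⟩
    N + w * 8                                ≤⟨ +-mono-≤ N≤M (m/n*n≤m (suc (suc M)) 8) ⟩
    M + suc (suc M)                          <⟨ ≤-offset (5 + M * 6) (gap M) ⟩
    suc M * 8                                ≤⟨ m≤n*m (suc M * 8) (suc p) ⟩
    suc p * (suc M * 8)                      ∎)
    where
    open ≤-Reasoning
    c = count f (suc (suc M))
    w = suc (suc M) div 8
    expand : ∀ x y d → ((x + y) * 8 + 23) * d ≡ (x * 8 + 23) * d + y * d * 8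
    expand = solve-∀
    gap : ∀ M → suc (M + suc (suc M)) + (5 + M * 6) ≡ suc M * 8
    gap = solve-∀

mainTheorem10 : ((m : ℕ) → 0 < m → m % 8 ≡ 5 →
    (IsGeom4 m → syrTriple m ≡ (m , 1 , 1))
    × (¬ IsGeom4 m →
    HasPattern (syrTriple m) (3 , 2 , 1) ⊎ HasPattern (syrTriple m) (3 , 1 , 2)))
    × HasDensity (A-pat (3 , 2 , 1)) (A-pat? (3 , 2 , 1)) ((+ 1) / 8)
    × HasDensity (A-pat (3 , 1 , 2)) (A-pat? (3 , 1 , 2)) ((+ 1) / 8)
mainTheorem10 =
  (λ m _ m%8≡5 → syrTriple-geom4 m , subst NonGeom4Patterns (sym (m≡5+q*8 m m%8≡5)) (patterns-5+q*8 (m div 8)))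
  , hasDensity-1/8 (A-pat (3 , 2 , 1)) (A-pat? (3 , 2 , 1)) (descent ∘ oddPart3q+ true) 4 (λ m m≢5 → m≢5 ∘ proj₁)
      does-A-pat321 (λ k → imbalance-oddPart3q+ descent true descent-1mod4 descent-3mod4 k true)
  , hasDensity-1/8 (A-pat (3 , 1 , 2)) (A-pat? (3 , 1 , 2)) (ascent ∘ oddPart3q+ true) 4 (λ m m≢5 → m≢5 ∘ proj₁)
      does-A-pat312 (λ k → imbalance-oddPart3q+ ascent false ascent-1mod4 ascent-3mod4 k true)
  where
  NonGeom4Patterns : ℕ → Set
  NonGeom4Patterns m = ¬ IsGeom4 m → HasPattern (syrTriple m) (3 , 2 , 1) ⊎ HasPattern (syrTriple m) (3 , 1 , 2)
  m≡5+q*8 : ∀ m → m % 8 ≡ 5 → m ≡ 5 + m div 8 * 8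
  m≡5+q*8 m m%8≡5 = trans (m≡m%n+[m/n]*n m 8) (cong (λ r → r + m div 8 * 8) m%8≡5)
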